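{- Let $A\in\mathcal{PM}(n)$, $B\in\mathcal{PM}(m)$ and $i\in[n]$. Then $A\circ^{\max}_{n-i+1}B=\left(A^*\circ^{\min}_i B^*\right)^*$.
   Context: A poset matrix of order $n$ is an $n\times n$ $(0,1)$-matrix $A=[a_{st}]$ that is lower triangular with all diagonal entries $1$ and transitive ($a_{st}=a_{tu}=1\Rightarrow a_{su}=1$); $\mathcal{PM}(n)$ is the set of these. For $A$ of order $N$, its dual is $A^*=EA^TE$, where $E$ is the $N\times N$ backward identity matrix. The poset associated to $B=[b_{st}]\in\mathcal{PM}(m)$ is $[m]$ with $t\le s$ iff $b_{st}=1$. $A[\alpha\mid\beta]$ is the submatrix with rows $\alpha$ and columns $\beta$, $A[\alpha]=A[\alpha\mid\alpha]$. For $A\in\mathcal{PM}(n)$ and $i\in[n]$: $A_{11}=A[\{1..i-1\}]$, $A_{22}=A[\{i+1..n\}]$, $A_{21}=A[\{i+1..n\}\mid\{1..i-1\}]$, $A_{(i)}=A[\{i\}\mid\{1..i-1\}]$, $A^{(i)}=A[\{i+1..n\}\mid\{i\}]$; empty blocks are vacuous. For $B\in\mathcal{PM}(m)$: $A\circ^{\min}_i B=\begin{pmatrix}A_{11}&\mathbb{O}&\mathbb{O}\\ \mathbb{1}_m^T\otimes A_{(i)}&B&\mathbb{O}\\ A_{21}&\mathrm{Min}_i(A,B)&A_{22}\end{pmatrix}$, $A\circ^{\max}_i B=\begin{pmatrix}A_{11}&\mathbb{O}&\mathbb{O}\\ \mathrm{Max}_i(A,B)&B&\mathbb{O}\\ A_{21}&\mathbb{1}_m\otimes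 A^{(i)}&A_{22}\end{pmatrix}$, where $\mathbb{1}_m^T\otimes A_{(i)}$ is the $m\times(i-1)$ matrix with all rows $A_{(i)}$, $\mathbb{1}_m\otimes A^{(i)}$ the $(n-i)\times m$ matrix with all columns $A^{(i)}$, $\mathrm{Min}_i(A,B)$ the $(n-i)\times m$ matrix whose $j$-th column is $A^{(i)}$ if $j$ is minimal in the poset of $B$ and zero otherwise, and $\mathrm{Max}_i(A,B)$ the $m\times(i-1)$ matrix whose $j$-th row is $A_{(i)}$ if $j$ is maximal in the poset of $B$ and zero otherwise. -}

module Defs where

open import Data.Nat using (ℕ; zero; suc; _+_; _∸_; _<_; _<?_)
open import Data.Fin using (Fin; toℕ; fromℕ<; opposite)
open import Data.Fin.Properties using (all?; _≟_)
open import Data.Bool using (Bool; true; false; if_then_else_; not; _∨_)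
open import Relation.Nullary.Decidable using (⌊_⌋; does)
open import Relation.Binary.PropositionalEquality using (_≡_)
open import Relation.Nullary using (yes; no)

-- An N×N (0,1)-matrix, entries indexed 0-based (row s, column t).
Mat : ℕ → Set
Mat N = Fin N → Fin N → Bool

record IsPosetMatrix {N : ℕ} (A : Mat N) : Set where
  field
    lowerTri : ∀ s t → toℕ s < toℕ t → A s t ≡ false
    diagOne  : ∀ s → A s s ≡ true
    trans    : ∀ s t u → A s t ≡ true → A t u ≡ true → A s u ≡ true

-- Backward identity E; dual A* = E Aᵀ E, i.e. (A*)_{st} = A_{N-1-t, N-1-s}.
dual : ∀ {N} → Mat N → Mat N
dual A s t = A (opposite t) (opposite s)

-- Poset of B: t ≤ s iff b_{st} = 1.
-- j minimal: every t with t ≤ j equals j, i.e. b_{jt} = 1 → t = j.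
isMinimal : ∀ {m} → Mat m → Fin m → Bool
isMinimal B j = does (all? (λ t → ⌊ t ≟ j ⌋ ∨ not (B j t) ≡? true))
  where
    open import Data.Bool.Properties using () renaming (_≟_ to _≡?_)

isMaximal : ∀ {m} → Mat m → Fin m → Bool
isMaximal B j = does (all? (λ s → ⌊ s ≟ j ⌋ ∨ not (B s j) ≡? true))
  where
    open import Data.Bool.Properties using () renaming (_≟_ to _≡?_)

-- Total lookup on ℕ indices (false out of range; never used out of range).
at : ∀ {N} → Mat N → ℕ → ℕ → Bool
at {N} M a b with a <? N | b <? N
... | yes p | yes q = M (fromℕ< p) (fromℕ< q)
... | _ | _ = false

atV : ∀ {m} → (Fin m → Bool) → ℕ → Bool
atV {m} f a with a <? m
... | yes p = f (fromℕ< p)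
... | _ = false

-- Position of row/column index t (0-based) of the composite of order (n-1)+m,
-- where c = i-1 is the 0-based index of the substituted vertex i of A:
--   t < c        : A-index t   (before i)
--   c ≤ t < c+m  : B-index t-c
--   t ≥ c+m      : A-index t+1-m (after i)
data Pos : Set where
  before : ℕ → Pos
  inB    : ℕ → Pos
  after  : ℕ → Pos

classify : (c m t : ℕ) → Pos
classify c m t with t <? c
... | yes _ = before t
... | no _ with t <? c + m
...   | yes _ = inB (t ∸ c)
...   | no _ = after (t + 1 ∸ m)

-- A ∘^min_i B  (i given 0-based as c = toℕ i), order k + m where n = suc k.
compMin : ∀ {k m} → Mat (suc k) → Mat m → Fin (suc k) → Mat (k + m)
compMin {k} {m} A B i s t = entry (classify c m (toℕ s)) (classify c m (toℕ t))
  where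
    c = toℕ i
    entry : Pos → Pos → Bool
    entry (before a) (before a') = at A a a'
    entry (before a) (inB b')    = false
    entry (before a) (after a')  = false
    entry (inB b)    (before a') = at A c a'
    entry (inB b)    (inB b')    = at B b b'
    entry (inB b)    (after a')  = false
    entry (after a)  (before a') = at A a a'
    entry (after a)  (inB b')    = if atV (isMinimal B) b' then at A a c else false
    entry (after a)  (after a')  = at A a a'

compMax : ∀ {k m} → Mat (suc k) → Mat m → Fin (suc k) → Mat (k + m)
compMax {k} {m} A B i s t = entry (classify c m (toℕ s)) (classify c m (toℕ t))
  where
    c = toℕ i
    entry : Pos → Pos → Bool
    entry (before a) (before a') = at A a a'
    entry (before a) (inB b')    = false
    entry (before a) (after a')  = false
    entry (inB b)    (before a') = if atV (isMaximal B) b then at A c a' else false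
    entry (inB b)    (inB b')    = at B b b'
    entry (inB b)    (after a')  = false
    entry (after a)  (before a') = at A a a'
    entry (after a)  (inB b')    = at A a c
    entry (after a)  (after a')  = at A a a'

-- Reversing the order of the k + m indices of a composite swaps its blocks before
-- and after the substituted vertex (A-index a ↦ k - a), reverses the block of B,
-- and moves the substituted vertex i to n - i + 1. Since (M*)_st = M_(N-1-t)(N-1-s),
-- every block of A ∘^max_(n-i+1) B is then read off the mirrored block of
-- A* ∘^min_i B*; for Max(A,B) versus Min(A*,B*) this uses that the maximal elements
-- of B are the minimal elements of B* in reversed numbering. No property of poset
-- matrices is used: the identity holds for all (0,1)-matrices A and B.
module Submission where

open import Defs
open import Data.Bool using (Bool; true; false; if_then_else_; not; _∨_)
open import Data.Fin using (Fin; opposite; toℕ; fromℕ<)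
open import Data.Fin.Properties
  using (toℕ<n; toℕ-fromℕ<; fromℕ<-toℕ; opposite-prop; opposite-involutive; all?; _≟_)
open import Data.Nat using (ℕ; suc; _+_; _∸_; _<_; _≮_; _<?_; s≤s)
open import Data.Nat.Properties
  using (+-comm; +-assoc; +-cancelˡ-≡; +-cancelʳ-≡; m+n∸m≡n; m+[n∸m]≡n; m≤m+n; m≤n+m;
         m+n≮m; ≮⇒≥; m≤n⇒∃[o]m+o≡n; +-monoʳ-<)
open import Data.Nat.Tactic.RingSolver using (solve-∀)
open import Data.Product using (Σ; _×_; _,_)
open import Function.Bundles using (_⇔_; mk⇔)
open import Relation.Nullary using (yes; no; contradiction)
open import Relation.Nullary.Decidable using (⌊_⌋; does-⇔)
open import Relation.Binary.PropositionalEquality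
  using (_≡_; refl; sym; trans; cong; cong₂; subst; subst₂; module ≡-Reasoning)
open ≡-Reasoning

data Opposite (N x y : ℕ) : Set where
  opposite-by : suc (x + y) ≡ N → Opposite N x y

Opposite-sym : ∀ {N x y} → Opposite N x y → Opposite N y x
Opposite-sym {x = x} {y} (opposite-by h) = opposite-by (trans (cong suc (+-comm y x)) h)

Opposite-toℕ : ∀ {n} (i : Fin n) → Opposite n (toℕ i) (toℕ (opposite i))
Opposite-toℕ i =
  opposite-by (trans (cong (λ z → suc (toℕ i + z)) (opposite-prop i)) (m+[n∸m]≡n (toℕ<n i)))

Opposite⇒toℕ : ∀ {N x y} → Opposite N x y →
               Σ (Fin N) λ f → toℕ f ≡ x × toℕ (opposite f) ≡ y
Opposite⇒toℕ {x = x} {y} (opposite-by refl) = f , toℕ-fromℕ< x<N , toℕ-opposite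
  where
    x<N : x < suc (x + y)
    x<N = s≤s (m≤m+n x y)
    f : Fin (suc (x + y))
    f = fromℕ< x<N
    toℕ-opposite : toℕ (opposite f) ≡ y
    toℕ-opposite = begin
      toℕ (opposite f)           ≡⟨ opposite-prop f ⟩
      x + y ∸ toℕ f              ≡⟨ cong (x + y ∸_) (toℕ-fromℕ< x<N) ⟩
      x + y ∸ x                  ≡⟨ m+n∸m≡n x y ⟩
      y                          ∎

at-toℕ : ∀ {N} (M : Mat N) (f g : Fin N) → at M (toℕ f) (toℕ g) ≡ M f g
at-toℕ {N} M f g with toℕ f <? N | toℕ g <? N
... | yes p | yes q = cong₂ M (fromℕ<-toℕ f p) (fromℕ<-toℕ g q)
... | no f≮N | _ = contradiction (toℕ<n f) f≮N
... | yes _ | no g≮N = contradiction (toℕ<n g) g≮N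

atV-toℕ : ∀ {N} (v : Fin N → Bool) (f : Fin N) → atV v (toℕ f) ≡ v f
atV-toℕ {N} v f with toℕ f <? N
... | yes p = cong v (fromℕ<-toℕ f p)
... | no f≮N = contradiction (toℕ<n f) f≮N

at-dual : ∀ {N x x' y y'} (M : Mat N) → Opposite N x x' → Opposite N y y' →
          at M x y ≡ at (dual M) y' x'
at-dual M hx hy with Opposite⇒toℕ hx | Opposite⇒toℕ hy
... | f , refl , refl | g , refl , refl = begin
  at M (toℕ f) (toℕ g)
    ≡⟨ at-toℕ M f g ⟩
  M f g
    ≡⟨ cong₂ M (opposite-involutive f) (opposite-involutive g) ⟨
  dual M (opposite g) (opposite f)
    ≡⟨ at-toℕ (dual M) (opposite g) (opposite f) ⟨
  at (dual M) (toℕ (opposite g)) (toℕ (opposite f)) ∎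

all-true-opposite : ∀ {n} {f g : Fin n → Bool} → (∀ t → f t ≡ g (opposite t)) →
                    (∀ t → f t ≡ true) ⇔ (∀ s → g s ≡ true)
all-true-opposite {f = f} {g} f≡g∘opp = mk⇔ to from
  where
    to : (∀ t → f t ≡ true) → ∀ s → g s ≡ true
    to all-f s = subst (λ u → g u ≡ true) (opposite-involutive s)
                       (trans (sym (f≡g∘opp (opposite s))) (all-f (opposite s)))
    from : (∀ s → g s ≡ true) → ∀ t → f t ≡ true
    from all-g t = trans (f≡g∘opp t) (all-g (opposite t))

≡-opposite⇒opposite-≡ : ∀ {n} {s t : Fin n} → s ≡ opposite t → opposite s ≡ t
≡-opposite⇒opposite-≡ {t = t} refl = opposite-involutive t

isMinimal-dual : ∀ {m} (B : Mat m) (j : Fin m) → isMinimal (dual B) (opposite j) ≡ isMaximal B j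
isMinimal-dual B j = does-⇔ (all-true-opposite minimality≡maximality) (all? _) (all? _)
  where
    eq-opposite : ∀ t → ⌊ t ≟ opposite j ⌋ ≡ ⌊ opposite t ≟ j ⌋
    eq-opposite t with t ≟ opposite j | opposite t ≟ j
    ... | yes _ | yes _ = refl
    ... | no _  | no _  = refl
    ... | yes e | no ne = contradiction (≡-opposite⇒opposite-≡ e) ne
    ... | no ne | yes e = contradiction (sym (≡-opposite⇒opposite-≡ (sym e))) ne
    minimality≡maximality : ∀ t → (⌊ t ≟ opposite j ⌋ ∨ not (dual B (opposite j) t))
                                  ≡ (⌊ opposite t ≟ j ⌋ ∨ not (B (opposite t) j))
    minimality≡maximality t =
      cong₂ _∨_ (eq-opposite t) (cong (λ u → not (B (opposite t) u)) (opposite-involutive j))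

atV-isMaximal-dual : ∀ {m b b'} (B : Mat m) → Opposite m b b' →
                     atV (isMaximal B) b ≡ atV (isMinimal (dual B)) b'
atV-isMaximal-dual B h with Opposite⇒toℕ h
... | f , refl , refl =
  trans (atV-toℕ (isMaximal B) f)
        (trans (sym (isMinimal-dual B f)) (sym (atV-toℕ (isMinimal (dual B)) (opposite f))))

classify-< : ∀ {a c} m → a < c → classify c m a ≡ before a
classify-< {a} {c} m a<c with a <? c
... | yes _ = refl
... | no a≮c = contradiction a<c a≮c

classify-+ : ∀ c {m b} → b < m → classify c m (c + b) ≡ inB b
classify-+ c {m} {b} b<m with c + b <? c
... | yes c+b<c = contradiction c+b<c (m+n≮m c b)
... | no _ with c + b <? c + m
...   | yes _ = cong inB (m+n∸m≡n c b)
...   | no c+b≮c+m = contradiction (+-monoʳ-< c b<m) c+b≮c+m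

classify-+-+ : ∀ c m r → classify c m (c + m + r) ≡ after (suc (c + r))
classify-+-+ c m r with c + m + r <? c
... | yes c+m+r<c = contradiction c+m+r<c (subst (_≮ c) (sym (+-assoc c m r)) (m+n≮m c (m + r)))
... | no _ with c + m + r <? c + m
...   | yes c+m+r<c+m = contradiction c+m+r<c+m (m+n≮m (c + m) r)
...   | no _ = cong after (trans (cong (_∸ m) (shift c m r)) (m+n∸m≡n m (suc (c + r))))
  where
    shift : ∀ c m r → c + m + r + 1 ≡ m + suc (c + r)
    shift = solve-∀

data Block (c m : ℕ) : ℕ → Set where
  before : ∀ {a} → a < c → Block c m a
  inB    : ∀ {b} → b < m → Block c m (c + b)
  after  : ∀ r → Block c m (c + m + r)

block : ∀ c m x → Block c m x
block c m x with x <? c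
... | yes x<c = before x<c
... | no x≮c with m≤n⇒∃[o]m+o≡n (≮⇒≥ x≮c)
...   | b , refl with b <? m
...     | yes b<m = inB b<m
...     | no b≮m with m≤n⇒∃[o]m+o≡n (≮⇒≥ b≮m)
...       | r , refl = subst (Block c m) (+-assoc c m r) (after r)

data OppositePos (k m : ℕ) : Pos → Pos → Set where
  before-after : ∀ {a r} → Opposite (suc k) a r → OppositePos k m (before a) (after r)
  inB-inB      : ∀ {b r} → Opposite m b r → OppositePos k m (inB b) (inB r)
  after-before : ∀ {a r} → Opposite (suc k) a r → OppositePos k m (after a) (before r)

classify-opposite-before : ∀ {a y c c'} m → a < c' → suc (a + y) ≡ c + c' + m →
                           OppositePos (c + c') m (before a) (classify c m y)
classify-opposite-before {a} {y} {c} m a<c' hx with m≤n⇒∃[o]m+o≡n a<c'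
... | d , refl =
  subst (OppositePos _ m (before a)) (sym classify-y) (before-after (opposite-by (sum≡ a c d)))
  where
    shift : ∀ a c d m → c + (suc a + d) + m ≡ suc a + (c + m + d)
    shift = solve-∀
    y≡ : y ≡ c + m + d
    y≡ = +-cancelˡ-≡ (suc a) y (c + m + d) (trans hx (shift a c d m))
    classify-y : classify c m y ≡ after (suc (c + d))
    classify-y = trans (cong (classify c m) y≡) (classify-+-+ c m d)
    sum≡ : ∀ a c d → suc (a + suc (c + d)) ≡ suc (c + (suc a + d))
    sum≡ = solve-∀

classify-opposite-inB : ∀ {b y c c' m} → b < m → suc (c' + b + y) ≡ c + c' + m →
                        OppositePos (c + c') m (inB b) (classify c m y)
classify-opposite-inB {b} {y} {c} {c'} b<m hx with m≤n⇒∃[o]m+o≡n b<m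
... | r , refl = subst (OppositePos _ _ (inB b)) (sym classify-y) (inB-inB (opposite-by refl))
  where
    shift : ∀ b c c' r → c + c' + (suc b + r) ≡ suc (c' + b) + (c + r)
    shift = solve-∀
    y≡ : y ≡ c + r
    y≡ = +-cancelˡ-≡ (suc (c' + b)) y (c + r) (trans hx (shift b c c' r))
    classify-y : classify c (suc b + r) y ≡ inB r
    classify-y = trans (cong (classify c _) y≡) (classify-+ c (s≤s (m≤n+m r b)))

classify-opposite-after : ∀ {r y c c'} m → suc (c' + m + r + y) ≡ c + c' + m →
                          OppositePos (c + c') m (after (suc (c' + r))) (classify c m y)
classify-opposite-after {r} {y} {c} {c'} m hx =
  subst (OppositePos _ m _) (sym (classify-< m y<c)) (after-before (opposite-by sum≡))
  where
    shift : ∀ c' m r y → suc (c' + m + r + y) ≡ suc (r + y) + (c' + m)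
    shift = solve-∀
    c≡ : c ≡ suc (r + y)
    c≡ = +-cancelʳ-≡ (c' + m) c (suc (r + y))
                     (trans (sym (+-assoc c c' m)) (trans (sym hx) (shift c' m r y)))
    y<c : y < c
    y<c = subst (y <_) (sym c≡) (s≤s (m≤n+m y r))
    mirror : ∀ c' r y → suc (suc (c' + r) + y) ≡ suc (suc (r + y) + c')
    mirror = solve-∀
    sum≡ : suc (suc (c' + r) + y) ≡ suc (c + c')
    sum≡ = trans (mirror c' r y) (cong (λ z → suc (z + c')) (sym c≡))

classify-opposite : ∀ {k m x y c c'} → Opposite (k + m) x y → Opposite (suc k) c c' →
                    OppositePos k m (classify c' m x) (classify c m y)
classify-opposite {m = m} {x} {y} {c} {c'} (opposite-by hx) (opposite-by refl) with block c' m x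
... | before a<c' rewrite classify-< m a<c'   = classify-opposite-before {y = y} {c} m a<c' hx
... | inB b<m     rewrite classify-+ c' b<m   = classify-opposite-inB {y = y} {c} b<m hx
... | after r     rewrite classify-+-+ c' m r = classify-opposite-after {y = y} {c} m hx

theorem11 : (k m : ℕ) (A : Mat (suc k)) (B : Mat m) → IsPosetMatrix A → IsPosetMatrix B →
    (i : Fin (suc k)) → (s t : Fin (k + m)) →
    compMax A B (opposite i) s t ≡ dual (compMin (dual A) (dual B) i) s t
theorem11 k m A B _ _ i s t
  with classify (toℕ (opposite i)) m (toℕ s) | classify (toℕ i) m (toℕ (opposite s))
     | classify-opposite (Opposite-toℕ s) (Opposite-toℕ i)
     | classify (toℕ (opposite i)) m (toℕ t) | classify (toℕ i) m (toℕ (opposite t))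
     | classify-opposite (Opposite-toℕ t) (Opposite-toℕ i)
... | _ | _ | before-after hs | _ | _ | before-after ht = at-dual A hs ht
... | _ | _ | before-after _  | _ | _ | inB-inB _       = refl
... | _ | _ | before-after _  | _ | _ | after-before _  = refl
... | _ | _ | inB-inB hs      | _ | _ | before-after ht =
  cong₂ (λ u v → if u then v else false)
        (atV-isMaximal-dual B hs) (at-dual A (Opposite-sym (Opposite-toℕ i)) ht)
... | _ | _ | inB-inB hs      | _ | _ | inB-inB ht      = at-dual B hs ht
... | _ | _ | inB-inB _       | _ | _ | after-before _  = refl
... | _ | _ | after-before hs | _ | _ | before-after ht = at-dual A hs ht
... | _ | _ | after-before hs | _ | _ | inB-inB _       =
  at-dual A hs (Opposite-sym (Opposite-toℕ i))
... | _ | _ | after-before hs | _ | _ | after-before ht = at-dual A hs ht
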